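{- Let $\mathcal B$ be a pseudometric betweenness on a set $V$ and let $a,b,c,x$ be four distinct points of $V$. If $[axb]$, $[bxc]$ and $[cxa]$ all hold, then $\{a,b,c\}$ is not collinear.
   Context: A ternary relation $\mathcal B$ on $V$ (write $[abc]$ for $(a,b,c)\in\mathcal B$) is a pseudometric betweenness if: (M0) if $[abc]$ then $a,b,c$ are distinct; (M1) if $[abc]$ then $[cba]$; (M2) if $[abc]$ then $[bac]$ does not hold; (M3) if $[abc]$ and $[acd]$ then $[abd]$ and $[bcd]$. A set $\{a,b,c\}$ of distinct points is collinear if one of $[abc],[bca],[cab]$ holds. -}

module Defs where

open import Level using (Level; _⊔_; suc)
open import Data.Product using (_×_)
open import Data.Sum using (_⊎_)
open import Relation.Nullary using (¬_)
open import Relation.Binary.PropositionalEquality using (_≡_)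

Distinct3 : ∀ {v} {V : Set v} → V → V → V → Set v
Distinct3 a b c = ¬ a ≡ b × ¬ a ≡ c × ¬ b ≡ c

record IsPseudometricBetweenness {v ℓ} {V : Set v} (B : V → V → V → Set ℓ) : Set (v ⊔ ℓ) where
  field
    M0 : ∀ {a b c} → B a b c → Distinct3 a b c
    M1 : ∀ {a b c} → B a b c → B c b a
    M2 : ∀ {a b c} → B a b c → ¬ B b a c
    M3 : ∀ {a b c d} → B a b c → B a c d → B a b d × B b c d

Collinear : ∀ {v ℓ} {V : Set v} → (V → V → V → Set ℓ) → V → V → V → Set (v ⊔ ℓ)
Collinear B a b c = Distinct3 a b c × (B a b c ⊎ B b c a ⊎ B c a b)

module Submission where

open import Defs
open import Data.Product using (_,_; proj₂)
open import Data.Sum using (inj₁; inj₂)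
open import Relation.Nullary using (¬_)
open import Relation.Binary.PropositionalEquality using (_≡_)

-- From [pxq] and [pqr], axiom M3 gives [xqr], which M2 forbids alongside [qxr].
module _ {v ℓ} {V : Set v} {B : V → V → V → Set ℓ}
         (isBetweenness : IsPseudometricBetweenness B) where

  open IsPseudometricBetweenness isBetweenness

  between-between⇒¬between : ∀ {p q r x} → B p x q → B q x r → ¬ B p q r
  between-between⇒¬between pxq qxr pqr = M2 (proj₂ (M3 pxq pqr)) qxr

mainTheorem11 : ∀ {v ℓ} {V : Set v} (B : V → V → V → Set ℓ) →
    IsPseudometricBetweenness B →
    (a b c x : V) →
    ¬ a ≡ b → ¬ a ≡ c → ¬ a ≡ x → ¬ b ≡ c → ¬ b ≡ x → ¬ c ≡ x →
    B a x b → B b x c → B c x a →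
    ¬ Collinear B a b c
mainTheorem11 B isB a b c x _ _ _ _ _ _ axb bxc cxa (_ , inj₁ abc) =
  between-between⇒¬between isB axb bxc abc
mainTheorem11 B isB a b c x _ _ _ _ _ _ axb bxc cxa (_ , inj₂ (inj₁ bca)) =
  between-between⇒¬between isB bxc cxa bca
mainTheorem11 B isB a b c x _ _ _ _ _ _ axb bxc cxa (_ , inj₂ (inj₂ cab)) =
  between-between⇒¬between isB cxa axb cab
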